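{- The parity family $\mathrm{PAR}=(\mathrm{PAR}_n)_{n\in\mathbb{N}}$ belongs to $\mathrm{IS}^1{:}B(2n+3)$; that is, there is $h:\mathbb{N}\to\mathbb{N}$ and $m\in\mathbb{N}$ with $h(n)\le 2n+3$ for all $n\ge m$, such that for every $n\in\mathbb{N}$ some instruction sequence in $\mathrm{IS}^1$ computes $\mathrm{PAR}_n$ and has length at most $h(n)$.
   Context: Booleans are $\mathrm{F}$ and $\mathrm{T}$. An instruction sequence is a finite sequence $u_1;u_2;\dots;u_k$ of primitive instructions; its length is $k$. Basic instructions are: $\mathrm{in}{:}i.\mathrm{get}$ ($i\ge1$), $\mathrm{out}.\mathrm{set}{:}b$ ($b\in\{\mathrm{F},\mathrm{T}\}$), $\mathrm{aux}{:}i.\mathrm{get}$, $\mathrm{aux}{:}i.\mathrm{set}{:}b$, $\mathrm{aux}{:}i.\mathrm{com}$ ($i\ge1$). Each names a Boolean register ($\mathrm{in}{:}i$ input, $\mathrm{out}$ output, $\mathrm{aux}{:}i$ auxiliary) and a command: $\mathrm{get}$ leaves the register unchanged and replies its content; $\mathrm{set}{:}b$ sets the content to $b$ and replies $b$; $\mathrm{com}$ complements the content and replies the new content. Primitive instructions: for each basic instruction $a$, plain $a$, positive test ${+}a$, negative test ${ - }a$; forward jumps $\#l$ ($l\in\mathbb{N}$); termination $!$. Execution starts at $u_1$. ${+}a$ executes $a$ and proceeds with the next instruction if the reply is $\mathrm{T}$, otherwise skips the next instruction and proceeds with the one after; ${ - }a$ likewise with replies reversed; plain $a$ executes $a$ and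 proceeds with the next instruction; $\#l$ proceeds with the $l$th next instruction; $!$ terminates. If $l=0$ or there is no instruction to proceed with, inaction occurs (no termination). $X$ computes $f:\{\mathrm{F},\mathrm{T}\}^n\to\{\mathrm{F},\mathrm{T}\}$ if there is $k\in\mathbb{N}$ (at least every auxiliary index used in $X$) such that for all $b_1,\dots,b_n$: starting with $\mathrm{in}{:}i$ containing $b_i$, $\mathrm{out}$ containing $\mathrm{F}$, and $\mathrm{aux}{:}1,\dots,\mathrm{aux}{:}k$ containing $\mathrm{F}$, execution terminates with $\mathrm{out}$ containing $f(b_1,\dots,b_n)$. $\mathrm{IS}^k$ denotes the set of instruction sequences in which no instruction of the form $\mathrm{aux}{:}i.c$, ${+}\mathrm{aux}{:}i.c$, ${ - }\mathrm{aux}{:}i.c$ with $i>k$ occurs. For a set $\mathcal{I}$ of instruction sequences and $f:\mathbb{N}\to\mathbb{N}$, $\mathcal{I}{:}B(f(n))$ is the class of Boolean function families $(f_n)_{n\in\mathbb{N}}$ ($f_n$ $n$-ary) for which there exists $h:\mathbb{N}\to\mathbb{N}$ with $h(n)\le f(n)$ for all sufficiently large $n$ such that for all $n$ there is $X\in\mathcal{I}$ computing $f_n$ with length at most $h(n)$. $\mathrm{PAR}_n(b_1,\dots,b_n)=\mathrm{T}$ iff the number of $\mathrm{T}$'s among $b_1,\dots,b_n$ is odd. -}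

module Defs where

open import Data.Bool using (Bool; true; false; not; if_then_else_)
open import Data.Nat using (ℕ; zero; suc; _≤_; _<_; _%_; _+_)
open import Data.Nat.Properties using (_≟_)
open import Data.Fin using (Fin; toℕ)
open import Data.Vec using (Vec; []; _∷_; lookup)
open import Data.List using (List; []; _∷_; drop)
open import Data.List.Relation.Unary.All using (All)
open import Data.Product using (_×_; _,_; ∃-syntax; Σ-syntax)
open import Data.Unit using (⊤)
open import Relation.Binary.PropositionalEquality using (_≡_)
open import Relation.Nullary using (does)

-- Booleans: F = false, T = true.

data Cmd : Set where
  get  : Cmd
  set  : Bool → Cmd
  com  : Cmd

data Basic : Set where
  inGet  : (i : ℕ) → 1 ≤ i → Basic                 -- in:i.get
  outSet : Bool → Basic                           -- out.set:b
  auxCmd : (i : ℕ) → 1 ≤ i → Cmd → Basic          -- aux:i.get / aux:i.set:b / aux:i.com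

data Instr : Set where
  plain : Basic → Instr
  ptest : Basic → Instr        -- +a
  ntest : Basic → Instr        -- -a
  jump  : ℕ → Instr            -- #l
  halt  : Instr                -- !

InstrSeq : Set
InstrSeq = List Instr

record State : Set where
  constructor st
  field
    inp : ℕ → Bool
    out : Bool
    aux : ℕ → Bool
open State public

update : (ℕ → Bool) → ℕ → Bool → (ℕ → Bool)
update f i b j = if does (j ≟ i) then b else f j

applyCmd : Cmd → Bool → Bool
applyCmd get b     = b
applyCmd (set c) _ = c
applyCmd com b     = not b

execBasic : Basic → State → Bool × State
execBasic (inGet i _) s    = inp s i , s
execBasic (outSet b) s     = b , st (inp s) b (aux s)
execBasic (auxCmd i _ c) s =
  applyCmd c (aux s i) , st (inp s) (out s) (update (aux s) i (applyCmd c (aux s i)))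

reply : Basic → State → Bool
reply a s = Data.Product.proj₁ (execBasic a s)

next : Basic → State → State
next a s = Data.Product.proj₂ (execBasic a s)

-- Running off the end or #0 is inaction
-- (no constructor applies).
data Terminates : InstrSeq → State → State → Set where
  t-halt  : ∀ {X s} → Terminates (halt ∷ X) s s
  t-plain : ∀ {a X s s'} → Terminates X (next a s) s' → Terminates (plain a ∷ X) s s'
  t-ptestT : ∀ {a X s s'} → reply a s ≡ true →
             Terminates X (next a s) s' → Terminates (ptest a ∷ X) s s'
  t-ptestF : ∀ {a u X s s'} → reply a s ≡ false →
             Terminates X (next a s) s' → Terminates (ptest a ∷ u ∷ X) s s'
  t-ntestF : ∀ {a X s s'} → reply a s ≡ false →
             Terminates X (next a s) s' → Terminates (ntest a ∷ X) s s'
  t-ntestT : ∀ {a u X s s'} → reply a s ≡ true →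
             Terminates X (next a s) s' → Terminates (ntest a ∷ u ∷ X) s s'
  t-jump  : ∀ {l X s s'} → Terminates (drop l X) s s' → Terminates (jump (suc l) ∷ X) s s'

basicInIS : ℕ → Basic → Set
basicInIS k (inGet _ _)    = ⊤
basicInIS k (outSet _)     = ⊤
basicInIS k (auxCmd i _ _) = i ≤ k

instrInIS : ℕ → Instr → Set
instrInIS k (plain a) = basicInIS k a
instrInIS k (ptest a) = basicInIS k a
instrInIS k (ntest a) = basicInIS k a
instrInIS k (jump _)  = ⊤
instrInIS k halt      = ⊤

InIS : ℕ → InstrSeq → Set
InIS k X = All (instrInIS k) X

-- X computes the n-ary Boolean function f.
-- Registers not specified by the definition (in:i for i > n, aux:i for i > k)
-- may have arbitrary initial content.
Computes : (n : ℕ) → (Vec Bool n → Bool) → InstrSeq → Set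
Computes n f X =
  Σ[ k ∈ ℕ ] (InIS k X ×
    ((b : Vec Bool n) (s : State) →
      ((j : Fin n) → inp s (suc (toℕ j)) ≡ lookup b j) →
      out s ≡ false →
      ((i : ℕ) → 1 ≤ i → i ≤ k → aux s i ≡ false) →
      Σ[ s' ∈ State ] (Terminates X s s' × out s' ≡ f b)))

len : InstrSeq → ℕ
len = Data.List.length

countT : ∀ {n} → Vec Bool n → ℕ
countT []           = 0
countT (true ∷ bs)  = suc (countT bs)
countT (false ∷ bs) = countT bs

PAR : (n : ℕ) → Vec Bool n → Bool
PAR n b = does (countT b % 2 ≟ 1)

ISB : (k : ℕ) → (g : ℕ → ℕ) → ((n : ℕ) → Vec Bool n → Bool) → Set
ISB k g F =
  Σ[ h ∈ (ℕ → ℕ) ] Σ[ m ∈ ℕ ] (((n : ℕ) → m ≤ n → h n ≤ g n) ×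
    ((n : ℕ) → Σ[ X ∈ InstrSeq ] (InIS k X × Computes n (F n) X × len X ≤ h n)))

module Submission where

-- The program uses aux:1 as a running parity bit.  For each input i it
-- contains the two-instruction block  +in:i.get ; aux:1.com , which
-- complements aux:1 exactly when in:i holds; after the n blocks the tail
--  +aux:1.get ; out.set:T ; !  copies aux:1 into out (out starts as F).
--
-- Correctness is an invariant proved by induction on the remaining inputs:
-- running the blocks for inputs k+1, …, k+m from a state whose aux:1 holds a
-- ends with out equal to a complemented once for every T among those inputs
-- (`flips`).  Starting from a = F this is the parity, since complementing F
-- c times gives T iff c is odd.

open import Defs
open import Data.Nat using (ℕ; zero; suc; _+_; _*_; _%_; _≤_; s≤s; z≤n)
open import Data.Nat.Properties using (_≟_; ≤-refl; +-suc; +-identityʳ)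
open import Data.Bool using (Bool; true; false; not)
open import Data.Fin using (Fin; toℕ) renaming (zero to fzero; suc to fsuc)
open import Data.Vec using (Vec; []; _∷_; lookup)
open import Data.List using ([]; _∷_)
open import Data.List.Relation.Unary.All using ([]; _∷_)
open import Data.Product using (_×_; _,_; Σ-syntax)
open import Data.Unit using (tt)
open import Relation.Binary.PropositionalEquality
  using (_≡_; refl; sym; trans; cong; subst)
open import Relation.Nullary using (does)

flips : ℕ → Bool → Bool
flips zero    a = a
flips (suc c) a = flips c (not a)

flips-false : (c : ℕ) → flips c false ≡ does (c % 2 ≟ 1)
flips-false zero          = refl
flips-false (suc zero)    = refl
flips-false (suc (suc c)) = flips-false c

1≤1 : 1 ≤ 1
1≤1 = s≤s z≤n

copyAux : InstrSeq
copyAux = ptest (auxCmd 1 1≤1 get) ∷ plain (outSet true) ∷ halt ∷ []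

parityFrom : ℕ → ℕ → InstrSeq
parityFrom k zero    = copyAux
parityFrom k (suc m) =
  ptest (inGet (suc k) (s≤s z≤n)) ∷ plain (auxCmd 1 1≤1 com) ∷ parityFrom (suc k) m

parityFrom-IS1 : (k m : ℕ) → InIS 1 (parityFrom k m)
parityFrom-IS1 k zero    = 1≤1 ∷ tt ∷ tt ∷ []
parityFrom-IS1 k (suc m) = tt ∷ 1≤1 ∷ parityFrom-IS1 (suc k) m

parityFrom-length : (k m : ℕ) → len (parityFrom k m) ≡ 2 * m + 3
parityFrom-length k zero    = refl
parityFrom-length k (suc m) rewrite parityFrom-length (suc k) m | +-suc m (m + 0) = refl

copyAux-run : (s : State) → out s ≡ false →
              Σ[ s' ∈ State ] (Terminates copyAux s s' × out s' ≡ aux s 1)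
copyAux-run s out≡F with aux s 1 in aux≡
... | true  = _ , t-ptestT aux≡ (t-plain t-halt) , refl
... | false = _ , t-ptestF aux≡ t-halt , out≡F

parityFrom-run :
  (k m : ℕ) (bs : Vec Bool m) (s : State) →
  ((j : Fin m) → inp s (suc (k + toℕ j)) ≡ lookup bs j) → out s ≡ false →
  Σ[ s' ∈ State ] (Terminates (parityFrom k m) s s' × out s' ≡ flips (countT bs) (aux s 1))
parityFrom-run k zero    []       s inputs out≡F = copyAux-run s out≡F
parityFrom-run k (suc m) (b ∷ bs) s inputs out≡F = step b refl
  where
  first : inp s (suc k) ≡ b
  first = subst (λ i → inp s (suc i) ≡ b) (+-identityʳ k) (inputs fzero)

  rest : (j : Fin m) → inp s (suc (suc k + toℕ j)) ≡ lookup bs j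
  rest j = subst (λ i → inp s (suc i) ≡ lookup bs j) (+-suc k (toℕ j)) (inputs (fsuc j))

  step : (c : Bool) → c ≡ b →
         Σ[ s' ∈ State ] (Terminates (parityFrom k (suc m)) s s'
                          × out s' ≡ flips (countT (b ∷ bs)) (aux s 1))
  step true refl with parityFrom-run (suc k) m bs _ rest out≡F
  ... | s' , run , out≡ = s' , t-ptestT first (t-plain run) , out≡
  step false refl with parityFrom-run (suc k) m bs s rest out≡F
  ... | s' , run , out≡ = s' , t-ptestF first run , out≡

parity-computes : (n : ℕ) → Computes n (PAR n) (parityFrom 0 n)
parity-computes n = 1 , parityFrom-IS1 0 n , correct
  where
  correct : (b : Vec Bool n) (s : State) →
            ((j : Fin n) → inp s (suc (toℕ j)) ≡ lookup b j) → out s ≡ false →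
            ((i : ℕ) → 1 ≤ i → i ≤ 1 → aux s i ≡ false) →
            Σ[ s' ∈ State ] (Terminates (parityFrom 0 n) s s' × out s' ≡ PAR n b)
  correct b s inputs out≡F aux≡F with parityFrom-run 0 n b s inputs out≡F
  ... | s' , run , out≡ = s' , run , trans out≡ parity
    where
    parity : flips (countT b) (aux s 1) ≡ PAR n b
    parity = trans (cong (flips (countT b)) (aux≡F 1 1≤1 1≤1)) (flips-false (countT b))

theorem2 : ISB 1 (λ n → 2 * n + 3) PAR
theorem2 = (λ n → 2 * n + 3) , 0 , (λ n _ → ≤-refl) , program
  where
  program : (n : ℕ) → Σ[ X ∈ InstrSeq ]
              (InIS 1 X × Computes n (PAR n) X × len X ≤ 2 * n + 3)
  program n = parityFrom 0 n , parityFrom-IS1 0 n , parity-computes n ,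
              subst (_≤ 2 * n + 3) (sym (parityFrom-length 0 n)) ≤-refl
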